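{- Assume Dickson's $k$-tuples conjecture. Then $\limsup_{m\in\mathscr{V}^{2}}\mathrm{A}(m)=\infty$; that is, for every $k\ge1$ there exists a totient $m\equiv 4\pmod 8$ with $\mathrm{A}(m)\ge k$. (Consequently $2$ is the smallest $\ell$ for which the multiplicities of totients in $\mathscr{V}^{\ell}$ are unbounded.)
   Context: $\phi$ is Euler's totient function, $\mathscr{V}$ the set of its values, $\mathrm{A}(m)=|\phi^{ -1}(m)|$, and $\mathscr{V}^{\ell}=\{m\in\mathscr{V}: m\equiv 2^{\ell}\pmod{2^{\ell+1}}\}$. Dickson's $k$-tuples conjecture: if $a_1n+b_1,\dots,a_kn+b_k$ are linear forms with integer coefficients, $a_i\ge1$, such that for every prime $p$ there is an integer $n$ with $p\nmid\prod_i(a_in+b_i)$ (an admissible tuple), then there are infinitely many positive integers $n$ for which all $a_in+b_i$ are simultaneously prime. -}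

module Defs where

open import Data.Nat using (ℕ; suc; _<_; _≤_; _%_)
open import Data.Nat.GCD using (gcd)
open import Data.Nat.Primality using (Prime)
open import Data.Nat.Properties using (_≟_)
open import Data.List using (List; length; filter; applyUpTo; map; foldr; all)
open import Data.List.Relation.Unary.All using (All)
open import Data.List.Relation.Unary.Unique.Propositional using (Unique)
open import Data.Integer as ℤ using (ℤ; +_)
open import Data.Integer.Divisibility as ℤD using ()
open import Data.Product using (_×_; _,_; Σ; ∃; proj₁; proj₂)
open import Relation.Nullary using (¬_)
open import Relation.Binary.PropositionalEquality using (_≡_)

-- Euler's totient: φ n = #{ 1 ≤ i ≤ n : gcd i n = 1 }  (so φ 0 = 0, φ 1 = 1)
φ : ℕ → ℕ
φ n = length (filter (λ i → gcd i n ≟ 1) (applyUpTo suc n))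

IsTotient : ℕ → Set
IsTotient m = ∃ λ n → φ n ≡ m

-- A(m) ≥ k, i.e. |φ⁻¹(m)| ≥ k : there are k distinct n with φ n = m
AtLeast : ℕ → ℕ → Set
AtLeast k m = Σ (List ℕ) λ ns → length ns ≡ k × Unique ns × All (λ n → φ n ≡ m) ns

LinForm : Set
LinForm = ℕ × ℤ

eval : LinForm → ℤ → ℤ
eval (a , b) n = (+ a) ℤ.* n ℤ.+ b

prodAt : List LinForm → ℤ → ℤ
prodAt fs n = foldr (λ f acc → eval f n ℤ.* acc) (+ 1) fs

Admissible : List LinForm → Set
Admissible fs = ∀ p → Prime p → ∃ λ (n : ℤ) → ¬ ((+ p) ℤD.∣ prodAt fs n)

IsPrimeℤ : ℤ → Set
IsPrimeℤ z = ∃ λ q → Prime q × z ≡ + q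

-- Dickson's k-tuples conjecture (for all k, i.e. all finite lists of forms)
Dickson : Set
Dickson = ∀ (fs : List LinForm) →
  All (λ f → 1 ≤ proj₁ f) fs → Admissible fs →
  ∀ (N : ℕ) → ∃ λ (n : ℕ) → N < n × All (λ f → IsPrimeℤ (eval f (+ n))) fs

{-# OPTIONS --safe #-}
-- For a prime p choose w with p ∣ 2(2w + 1); every form 4·3ⁱ·n + 2·3ⁱ + 1 is then
-- ≡ 1 (mod p) at n = w, so these forms are admissible, and Dickson's conjecture gives
-- an n for which all Pᵢ = 2t·3ⁱ + 1 (t = 2n + 1, i ≤ K = 2k + 1) are prime.  For i ≤ k
-- the numbers Pᵢ·P_{K−i} are products of two distinct primes with totient
-- (2t·3ⁱ)(2t·3^{K−i}) = 4·3^K·t² ≡ 4 (mod 8), and they are pairwise distinct because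
-- they strictly decrease in i.
module Submission where

open import Defs
open import Data.Nat
open import Data.Nat.Properties
open import Data.Nat.Divisibility
open import Data.Nat.DivMod using (m≡m%n+[m/n]*n; m%n<n; [m+kn]%n≡m%n; %-distribˡ-*; _/_)
open import Data.Nat.GCD using (gcd; gcd-greatest)
open import Data.Nat.LCM using (lcm; lcm-least; gcd*lcm)
open import Data.Nat.Coprimality as Coprime
  using (Coprime; coprime-factors; coprime⇒gcd≡1)
open import Data.Nat.Primality using (Prime; prime⇒irreducible; prime⇒nonTrivial; prime⇒nonZero; euclidsLemma)
open import Data.Nat.Tactic.RingSolver using (solve-∀)
open import Data.List using ([]; _∷_; [_]; _++_; length; filter; applyUpTo)
open import Data.List.Properties using (applyUpTo-∷ʳ; filter-++; length-++; length-applyUpTo)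
open import Data.List.Relation.Unary.All using (All; []; _∷_)
import Data.List.Relation.Unary.All.Properties as All
import Data.List.Relation.Unary.Unique.Propositional.Properties as Unique
open import Data.Integer as ℤ using (+_)
open import Data.Integer.Properties using (pos-+; pos-*; abs-*; +-injective)
import Data.Integer.Divisibility as ℤ
open import Data.Product using (_×_; _,_; ∃; proj₁; proj₂)
open import Data.Sum using (inj₁; inj₂)
open import Function using (_∘_; _⇔_; mk⇔; Equivalence)
open import Level using (Level)
open import Relation.Nullary using (¬_; Dec; yes; no; contradiction)
open import Relation.Unary using (Pred; Decidable)
open import Relation.Binary.PropositionalEquality hiding ([_])

private
  variable
    ℓ : Level
    i j m n p q : ℕ

indicator : ∀ {A : Set ℓ} → Dec A → ℕ
indicator (yes _) = 1
indicator (no _)  = 0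

indicator-yes : ∀ {A : Set ℓ} (a? : Dec A) → A → indicator a? ≡ 1
indicator-yes (yes _) _ = refl
indicator-yes (no ¬a) a = contradiction a ¬a

indicator-no : ∀ {A : Set ℓ} (a? : Dec A) → ¬ A → indicator a? ≡ 0
indicator-no (yes a) ¬a = contradiction a ¬a
indicator-no (no _)  _  = refl

-- counts over 1, …, n, so that φ n is definitionally count (λ i → gcd i n ≟ 1) n
count : {P : Pred ℕ ℓ} → Decidable P → ℕ → ℕ
count P? n = length (filter P? (applyUpTo suc n))

module _ {P : Pred ℕ ℓ} (P? : Decidable P) where

  length-filter-[_] : ∀ x → length (filter P? [ x ]) ≡ indicator (P? x)
  length-filter-[ x ] with P? x
  ... | yes _ = refl
  ... | no _  = refl

  count-suc : ∀ n → count P? (suc n) ≡ count P? n + indicator (P? (suc n))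
  count-suc n = begin
    length (filter P? (applyUpTo suc (suc n)))
      ≡⟨ cong (length ∘ filter P?) (applyUpTo-∷ʳ suc n) ⟨
    length (filter P? (applyUpTo suc n ++ [ suc n ]))
      ≡⟨ cong length (filter-++ P? (applyUpTo suc n) [ suc n ]) ⟩
    length (filter P? (applyUpTo suc n) ++ filter P? [ suc n ])
      ≡⟨ length-++ (filter P? (applyUpTo suc n)) ⟩
    count P? n + length (filter P? [ suc n ])
      ≡⟨ cong (_+_ (count P? n)) length-filter-[ suc n ] ⟩
    count P? n + indicator (P? (suc n)) ∎
    where open ≡-Reasoning

count-inclusion-exclusion :
  {N A B C : Pred ℕ ℓ} (N? : Decidable N) (A? : Decidable A) (B? : Decidable B) (C? : Decidable C) →
  (∀ i → N i ⇔ (¬ A i × ¬ B i)) → (∀ i → C i ⇔ (A i × B i)) →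
  ∀ n → count N? n + count A? n + count B? n ≡ n + count C? n
count-inclusion-exclusion N? A? B? C? N⇔ C⇔ = go
  where
  open Equivalence

  indicators : ∀ i → indicator (N? i) + indicator (A? i) + indicator (B? i) ≡ 1 + indicator (C? i)
  indicators i with A? i | B? i
  ... | yes a | yes b
    rewrite indicator-no (N? i) (λ Ni → proj₁ (to (N⇔ i) Ni) a)
          | indicator-yes (C? i) (from (C⇔ i) (a , b)) = refl
  ... | yes a | no ¬b
    rewrite indicator-no (N? i) (λ Ni → proj₁ (to (N⇔ i) Ni) a)
          | indicator-no (C? i) (¬b ∘ proj₂ ∘ to (C⇔ i)) = refl
  ... | no ¬a | yes b
    rewrite indicator-no (N? i) (λ Ni → proj₂ (to (N⇔ i) Ni) b)
          | indicator-no (C? i) (¬a ∘ proj₁ ∘ to (C⇔ i)) = refl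
  ... | no ¬a | no ¬b
    rewrite indicator-yes (N? i) (from (N⇔ i) (¬a , ¬b))
          | indicator-no (C? i) (¬a ∘ proj₁ ∘ to (C⇔ i)) = refl

  interchange : ∀ a b c d e f → (a + b) + (c + d) + (e + f) ≡ (a + c + e) + (b + d + f)
  interchange = solve-∀

  shift : ∀ a b c → (a + b) + (1 + c) ≡ suc a + (b + c)
  shift = solve-∀

  go : ∀ n → count N? n + count A? n + count B? n ≡ n + count C? n
  go zero    = refl
  go (suc n) = begin
    count N? (suc n) + count A? (suc n) + count B? (suc n)
      ≡⟨ cong₂ _+_ (cong₂ _+_ (count-suc N? n) (count-suc A? n)) (count-suc B? n) ⟩
    (count N? n + indicator (N? (suc n))) + (count A? n + indicator (A? (suc n)))
      + (count B? n + indicator (B? (suc n)))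
      ≡⟨ interchange (count N? n) (indicator (N? (suc n))) (count A? n) (indicator (A? (suc n)))
                     (count B? n) (indicator (B? (suc n))) ⟩
    (count N? n + count A? n + count B? n)
      + (indicator (N? (suc n)) + indicator (A? (suc n)) + indicator (B? (suc n)))
      ≡⟨ cong₂ _+_ (go n) (indicators (suc n)) ⟩
    (n + count C? n) + (1 + indicator (C? (suc n)))
      ≡⟨ shift n (count C? n) (indicator (C? (suc n))) ⟩
    suc n + (count C? n + indicator (C? (suc n)))
      ≡⟨ cong (_+_ (suc n)) (count-suc C? n) ⟨
    suc n + count C? (suc n) ∎
    where open ≡-Reasoning

count-multiples : ∀ d c .{{_ : NonZero d}} → count (d ∣?_) (d * c) ≡ c
count-multiples d@(suc e) c = trans (cong (count (d ∣?_)) (sym (+-identityʳ (d * c)))) (below c 0 z≤n)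
  where
  open ≡-Reasoning

  -- of d c + 1, …, d c + d only the last is a multiple of d
  below : ∀ c r → r ≤ e → count (d ∣?_) (d * c + r) ≡ c
  below zero    zero    _   = cong (count (d ∣?_)) (trans (+-identityʳ (d * 0)) (*-zeroʳ d))
  below (suc c) zero    _   = begin
    count (d ∣?_) (d * suc c + 0)
      ≡⟨ cong (count (d ∣?_)) (last-of-block e c) ⟩
    count (d ∣?_) (suc (d * c + e))
      ≡⟨ count-suc (d ∣?_) (d * c + e) ⟩
    count (d ∣?_) (d * c + e) + indicator (d ∣? suc (d * c + e))
      ≡⟨ cong₂ _+_ (below c e ≤-refl) (indicator-yes (d ∣? _) (divides (suc c) (last-of-block-∣ e c))) ⟩
    c + 1
      ≡⟨ +-comm c 1 ⟩
    suc c ∎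
    where
    last-of-block : ∀ e c → suc e * suc c + 0 ≡ suc (suc e * c + e)
    last-of-block = solve-∀
    last-of-block-∣ : ∀ e c → suc (suc e * c + e) ≡ suc c * suc e
    last-of-block-∣ = solve-∀
  below c       (suc r) r<e = begin
    count (d ∣?_) (d * c + suc r)
      ≡⟨ cong (count (d ∣?_)) (+-suc (d * c) r) ⟩
    count (d ∣?_) (suc (d * c + r))
      ≡⟨ count-suc (d ∣?_) (d * c + r) ⟩
    count (d ∣?_) (d * c + r) + indicator (d ∣? suc (d * c + r))
      ≡⟨ cong₂ _+_ (below c r (<⇒≤ r<e)) (indicator-no (d ∣? _) d∤) ⟩
    c + 0
      ≡⟨ +-identityʳ c ⟩
    c ∎
    where
    d∤ : ¬ d ∣ suc (d * c + r)
    d∤ d∣ = <⇒≱ (s≤s r<e) (∣⇒≤ (∣m+n∣m⇒∣n (subst (d ∣_) (sym (+-suc (d * c) r)) d∣) (m∣m*n c)))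

prime∤1 : Prime p → ¬ p ∣ 1
prime∤1 pp p∣1 = nonTrivial⇒≢1 {{prime⇒nonTrivial pp}} (∣1⇒≡1 p∣1)

prime∤⇒coprime : Prime p → ¬ p ∣ n → Coprime p n
prime∤⇒coprime pp p∤n (i∣p , i∣n) with prime⇒irreducible pp i∣p
... | inj₁ i≡1 = i≡1
... | inj₂ refl = contradiction i∣n p∤n

coprime-*ʳ : Coprime n p → Coprime n q → Coprime n (p * q)
coprime-*ʳ {q = q} n⊥p n⊥q (i∣n , i∣pq) = n⊥q (i∣n , coprime-factors n⊥p (∣m⇒∣m*n q i∣n , i∣pq))

coprime⇒*∣ : Coprime p q → p ∣ n → q ∣ n → p * q ∣ n
coprime⇒*∣ {p} {q} p⊥q p∣n q∣n = subst (_∣ _) lcm≡* (lcm-least p∣n q∣n)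
  where
  lcm≡* : lcm p q ≡ p * q
  lcm≡* = trans (sym (*-identityˡ (lcm p q)))
            (trans (cong (_* lcm p q) (sym (coprime⇒gcd≡1 p⊥q))) (gcd*lcm p q))

gcd[n,p*q]≡1⇔ : Prime p → Prime q → gcd n (p * q) ≡ 1 ⇔ (¬ p ∣ n × ¬ q ∣ n)
gcd[n,p*q]≡1⇔ {p} {q} {n} pp pq = mk⇔
  (λ g≡1 → (λ p∣n → prime∤1 pp (subst (p ∣_) g≡1 (gcd-greatest p∣n (m∣m*n q))))
         , (λ q∣n → prime∤1 pq (subst (q ∣_) g≡1 (gcd-greatest q∣n (n∣m*n p)))))
  (λ (p∤n , q∤n) → coprime⇒gcd≡1
    (coprime-*ʳ (Coprime.sym (prime∤⇒coprime pp p∤n)) (Coprime.sym (prime∤⇒coprime pq q∤n))))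

*∣⇔ : Prime p → Prime q → p ≢ q → p * q ∣ n ⇔ (p ∣ n × q ∣ n)
*∣⇔ {p} {q} pp pq p≢q = mk⇔
  (λ pq∣n → ∣-trans (m∣m*n q) pq∣n , ∣-trans (n∣m*n p) pq∣n)
  (λ (p∣n , q∣n) → coprime⇒*∣ (prime∤⇒coprime pp p∤q) p∣n q∣n)
  where
  p∤q : ¬ p ∣ q
  p∤q p∣q with prime⇒irreducible pq p∣q
  ... | inj₁ p≡1 = prime∤1 pp (∣-reflexive p≡1)
  ... | inj₂ p≡q = p≢q p≡q

-- inclusion–exclusion over 1, …, p q, stated additively to avoid truncated subtraction
φ[p*q]+q+p : Prime p → Prime q → p ≢ q → φ (p * q) + q + p ≡ p * q + 1
φ[p*q]+q+p {p} {q} pp pq p≢q = begin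
  φ (p * q) + q + p
    ≡⟨ cong₂ (λ a b → φ (p * q) + a + b)
         (sym (count-multiples p q)) (sym (trans (cong (count (q ∣?_)) (*-comm p q)) (count-multiples q p))) ⟩
  φ (p * q) + count (p ∣?_) (p * q) + count (q ∣?_) (p * q)
    ≡⟨ count-inclusion-exclusion (λ i → gcd i (p * q) ≟ 1) (p ∣?_) (q ∣?_) (p * q ∣?_)
         (λ _ → gcd[n,p*q]≡1⇔ pp pq) (λ _ → *∣⇔ pp pq p≢q) (p * q) ⟩
  p * q + count (p * q ∣?_) (p * q)
    ≡⟨ cong (_+_ (p * q)) (trans (cong (count _) (sym (*-identityʳ (p * q)))) (count-multiples (p * q) 1)) ⟩
  p * q + 1 ∎
  where
  open ≡-Reasoning
  instance
    p≢0 : NonZero p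
    p≢0 = prime⇒nonZero pp
    q≢0 : NonZero q
    q≢0 = prime⇒nonZero pq
    pq≢0 : NonZero (p * q)
    pq≢0 = m*n≢0 p q

φ-distinct-primes : Prime p → Prime q → p ≢ q → φ (p * q) ≡ (p ∸ 1) * (q ∸ 1)
φ-distinct-primes {suc p} {suc q} pp pq p≢q =
  +-cancelʳ-≡ (suc q + suc p) (φ (suc p * suc q)) (p * q)
    (trans (sym (+-assoc (φ (suc p * suc q)) (suc q) (suc p))) (trans (φ[p*q]+q+p pp pq p≢q) (expand p q)))
  where
  expand : ∀ p q → suc p * suc q + 1 ≡ p * q + (suc q + suc p)
  expand = solve-∀

odd-* : m % 2 ≡ 1 → n % 2 ≡ 1 → (m * n) % 2 ≡ 1
odd-* {m} {n} m-odd n-odd = trans (%-distribˡ-* m n 2) (cong₂ (λ a b → (a * b) % 2) m-odd n-odd)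

odd-^ : m % 2 ≡ 1 → ∀ k → (m ^ k) % 2 ≡ 1
odd-^ m-odd zero    = refl
odd-^ {m} m-odd (suc k) = odd-* {m} {m ^ k} m-odd (odd-^ m-odd k)

[1+2n]%2≡1 : ∀ n → suc (2 * n) % 2 ≡ 1
[1+2n]%2≡1 n = trans (cong (λ x → suc x % 2) (*-comm 2 n)) ([m+kn]%n≡m%n 1 n 2)

[4*odd]%8≡4 : ∀ x → x % 2 ≡ 1 → (4 * x) % 8 ≡ 4
[4*odd]%8≡4 x x-odd = begin
  (4 * x) % 8
    ≡⟨ cong (λ y → (4 * y) % 8) (m≡m%n+[m/n]*n x 2) ⟩
  (4 * (x % 2 + x / 2 * 2)) % 8
    ≡⟨ cong (λ r → (4 * (r + x / 2 * 2)) % 8) x-odd ⟩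
  (4 * (1 + x / 2 * 2)) % 8
    ≡⟨ cong (_% 8) (regroup (x / 2)) ⟩
  (4 + x / 2 * 8) % 8
    ≡⟨ [m+kn]%n≡m%n 4 (x / 2) 8 ⟩
  4 ∎
  where
  open ≡-Reasoning
  regroup : ∀ h → 4 * (1 + h * 2) ≡ 4 + h * 8
  regroup = solve-∀

prime∣2*odd : Prime p → ∃ λ w → p ∣ 2 * suc (2 * w)
prime∣2*odd {p} pp with p % 2 | m≡m%n+[m/n]*n p 2 | m%n<n p 2
... | 0 | p≡ | _ with prime⇒irreducible pp {2} (divides (p / 2) p≡)
...   | inj₁ ()
...   | inj₂ refl = 0 , ∣-refl
prime∣2*odd {p} pp | 1 | p≡ | _ =
  p / 2 , divides 2 (trans (regroup (p / 2)) (cong (2 *_) (sym p≡)))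
  where
  regroup : ∀ h → 2 * suc (2 * h) ≡ 2 * (1 + h * 2)
  regroup = solve-∀
prime∣2*odd pp | suc (suc _) | _ | s≤s (s≤s ())

stepwise-decreasing⇒decreasing : ∀ (f : ℕ → ℕ) k → (∀ {i} → suc i ≤ k → f (suc i) < f i) →
                                 ∀ {i j} → i < j → j ≤ k → f j < f i
stepwise-decreasing⇒decreasing f k step i<j = go (≤⇒≤′ i<j)
  where
  go : ∀ {i j} → suc i ≤′ j → j ≤ k → f j < f i
  go ≤′-refl             j≤k = step j≤k
  go (≤′-step {j} i<′j) j≤k = <-trans (step j≤k) (go i<′j (≤-trans (n≤1+n j) j≤k))

candidate : ℕ → ℕ → ℕ
candidate t i = 2 * t * 3 ^ i + 1

candidate-monoʳ-< : ∀ t .{{_ : NonZero t}} → i < j → candidate t i < candidate t j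
candidate-monoʳ-< t i<j = +-monoˡ-< 1 (*-monoʳ-< (2 * t) {{m*n≢0 2 t}} (^-monoʳ-< 3 (s≤s (s≤s z≤n)) i<j))

candidate-exchange : ∀ t .{{_ : NonZero t}} → i < j →
                     candidate t (suc i) * candidate t j < candidate t i * candidate t (suc j)
candidate-exchange {i} {j} t i<j = begin-strict
  candidate t (suc i) * candidate t j      ≡⟨ expandˡ t X Y ⟩
  B + 2 * t * (3 * X + Y)                  <⟨ +-monoʳ-< B (*-monoʳ-< (2 * t) {{m*n≢0 2 t}} 3X+Y<X+3Y) ⟩
  B + 2 * t * (X + 3 * Y)                  ≡⟨ expandʳ t X Y ⟨
  candidate t i * candidate t (suc j)      ∎
  where
  open ≤-Reasoning
  X = 3 ^ i
  Y = 3 ^ j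
  B = 3 * (2 * t * X) * (2 * t * Y) + 1
  X<Y : X < Y
  X<Y = ^-monoʳ-< 3 (s≤s (s≤s z≤n)) i<j
  3X+Y<X+3Y : 3 * X + Y < X + 3 * Y
  3X+Y<X+3Y = subst₂ _<_ (sym (splitˡ X Y)) (sym (splitʳ X Y)) (+-monoʳ-< X (+-monoˡ-< Y (*-monoʳ-< 2 X<Y)))
    where
    splitˡ : ∀ a b → 3 * a + b ≡ a + (2 * a + b)
    splitˡ = solve-∀
    splitʳ : ∀ a b → a + 3 * b ≡ a + (2 * b + b)
    splitʳ = solve-∀
  expandˡ : ∀ t X Y → (2 * t * (3 * X) + 1) * (2 * t * Y + 1) ≡ 3 * (2 * t * X) * (2 * t * Y) + 1 + 2 * t * (3 * X + Y)
  expandˡ = solve-∀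
  expandʳ : ∀ t X Y → (2 * t * X + 1) * (2 * t * (3 * Y) + 1) ≡ 3 * (2 * t * X) * (2 * t * Y) + 1 + 2 * t * (X + 3 * Y)
  expandʳ = solve-∀

φ-candidate-pair : ∀ t .{{_ : NonZero t}} → i < j → Prime (candidate t i) → Prime (candidate t j) →
                   φ (candidate t i * candidate t j) ≡ 4 * (3 ^ (i + j) * (t * t))
φ-candidate-pair {i} {j} t i<j pi pj = begin
  φ (candidate t i * candidate t j)
    ≡⟨ φ-distinct-primes pi pj (<⇒≢ (candidate-monoʳ-< t i<j)) ⟩
  (candidate t i ∸ 1) * (candidate t j ∸ 1)
    ≡⟨ cong₂ _*_ (m+n∸n≡m (2 * t * 3 ^ i) 1) (m+n∸n≡m (2 * t * 3 ^ j) 1) ⟩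
  2 * t * 3 ^ i * (2 * t * 3 ^ j)
    ≡⟨ regroup t (3 ^ i) (3 ^ j) ⟩
  4 * (3 ^ i * 3 ^ j * (t * t))
    ≡⟨ cong (λ x → 4 * (x * (t * t))) (^-distribˡ-+-* 3 i j) ⟨
  4 * (3 ^ (i + j) * (t * t)) ∎
  where
  open ≡-Reasoning
  regroup : ∀ t X Y → 2 * t * X * (2 * t * Y) ≡ 4 * (X * Y * (t * t))
  regroup = solve-∀

candidate-pairs⇒AtLeast : ∀ t .{{_ : NonZero t}} k → (∀ {i} → i ≤ k + suc k → Prime (candidate t i)) →
                          AtLeast (suc k) (4 * (3 ^ (k + suc k) * (t * t)))
candidate-pairs⇒AtLeast t k prime =
  applyUpTo Q (suc k) , length-applyUpTo Q (suc k) ,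
  Unique.applyUpTo⁺₁ Q (suc k) (λ i<j j≤k → >⇒≢ (Q-decreasing i<j (s≤s⁻¹ j≤k))) ,
  All.applyUpTo⁺₁ Q (suc k) (φ-Q ∘ s≤s⁻¹)
  where
  K = k + suc k
  Q : ℕ → ℕ
  Q i = candidate t i * candidate t (K ∸ i)

  ≤K : i ≤ k → i ≤ K
  ≤K i≤k = ≤-trans i≤k (m≤m+n k (suc k))

  <mirror : i ≤ k → i < K ∸ i
  <mirror {i} i≤k = <-≤-trans (s≤s i≤k) (subst (_≤ K ∸ i) (m+n∸m≡n k (suc k)) (∸-monoʳ-≤ K i≤k))

  φ-Q : i ≤ k → φ (Q i) ≡ 4 * (3 ^ K * (t * t))
  φ-Q {i} i≤k = trans (φ-candidate-pair t (<mirror i≤k) (prime (≤K i≤k)) (prime (m∸n≤m K i)))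
                      (cong (λ e → 4 * (3 ^ e * (t * t))) (m+[n∸m]≡n (≤K i≤k)))

  Q-step : suc i ≤ k → Q (suc i) < Q i
  -- +-∸-assoc 1 : suc K ∸ suc i ≡ suc (K ∸ suc i), and the left side is K ∸ i
  Q-step {i} i<k = subst (λ x → Q (suc i) < candidate t i * candidate t x)
    (sym (+-∸-assoc 1 (≤K i<k))) (candidate-exchange t (<-trans (n<1+n i) (<mirror i<k)))

  Q-decreasing : i < j → j ≤ k → Q j < Q i
  Q-decreasing = stepwise-decreasing⇒decreasing Q k Q-step

atLeast⇒isTotient : AtLeast (suc n) m → IsTotient m
atLeast⇒isTotient (x ∷ _ , _ , _ , φx≡m ∷ _) = x , φx≡m

form : ℕ → LinForm
form i = 4 * 3 ^ i , + (2 * 3 ^ i + 1)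

eval-form : ∀ i n → eval (form i) (+ n) ≡ + candidate (suc (2 * n)) i
eval-form i n = begin
  + (4 * 3 ^ i) ℤ.* + n ℤ.+ + (2 * 3 ^ i + 1)
    ≡⟨ cong (ℤ._+ + (2 * 3 ^ i + 1)) (pos-* (4 * 3 ^ i) n) ⟨
  + (4 * 3 ^ i * n) ℤ.+ + (2 * 3 ^ i + 1)
    ≡⟨ pos-+ (4 * 3 ^ i * n) (2 * 3 ^ i + 1) ⟨
  + (4 * 3 ^ i * n + (2 * 3 ^ i + 1))
    ≡⟨ cong +_ (regroup (3 ^ i) n) ⟩
  + candidate (suc (2 * n)) i ∎
  where
  open ≡-Reasoning
  regroup : ∀ X n → 4 * X * n + (2 * X + 1) ≡ 2 * suc (2 * n) * X + 1
  regroup = solve-∀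

prime∤prodAt : Prime p → ∀ fs z → All (λ f → ¬ + p ℤ.∣ eval f z) fs → ¬ + p ℤ.∣ prodAt fs z
prime∤prodAt pp []       z []           p∣1 = prime∤1 pp p∣1
prime∤prodAt pp (f ∷ fs) z (p∤f ∷ p∤fs) p∣f*fs
  with euclidsLemma ℤ.∣ eval f z ∣ ℤ.∣ prodAt fs z ∣ pp (subst (_ ∣_) (abs-* (eval f z) (prodAt fs z)) p∣f*fs)
... | inj₁ p∣f  = p∤f p∣f
... | inj₂ p∣fs = prime∤prodAt pp fs z p∤fs p∣fs

prime∤candidate : ∀ t → Prime p → p ∣ 2 * t → ∀ i → ¬ p ∣ candidate t i
prime∤candidate t pp p∣2t i p∣c = prime∤1 pp (∣m+n∣m⇒∣n p∣c (∣m⇒∣m*n (3 ^ i) p∣2t))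

forms-admissible : ∀ K → Admissible (applyUpTo form K)
forms-admissible K p pp with prime∣2*odd pp
... | w , p∣2t = + w , prime∤prodAt pp (applyUpTo form K) (+ w) (All.applyUpTo⁺₂ form K p∤form)
  where
  p∤form : ∀ i → ¬ + p ℤ.∣ eval (form i) (+ w)
  p∤form i = prime∤candidate (suc (2 * w)) pp p∣2t i ∘ subst (+ p ℤ.∣_) (eval-form i w)

forms-positive : ∀ K → All (λ f → 1 ≤ proj₁ f) (applyUpTo form K)
forms-positive K = All.applyUpTo⁺₂ form K (λ i → *-mono-≤ {1} {4} (s≤s z≤n) (m^n>0 3 i))

dickson⇒candidates-prime : Dickson → ∀ K → ∃ λ n → ∀ {i} → i ≤ K → Prime (candidate (suc (2 * n)) i)
dickson⇒candidates-prime dickson K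
  with dickson (applyUpTo form (suc K)) (forms-positive (suc K)) (forms-admissible (suc K)) 0
... | n , _ , primeValues = n , λ {i} i≤K → primeCandidate i (All.applyUpTo⁻ form (suc K) primeValues (s≤s i≤K))
  where
  primeCandidate : ∀ i → IsPrimeℤ (eval (form i) (+ n)) → Prime (candidate (suc (2 * n)) i)
  primeCandidate i (q , q-prime , f≡q) = subst Prime (+-injective (trans (sym f≡q) (eval-form i n))) q-prime

theorem3p2 : Dickson → ∀ (k : ℕ) → 1 ≤ k →
    ∃ λ (m : ℕ) → m % 8 ≡ 4 × IsTotient m × AtLeast k m
theorem3p2 dickson (suc k) _ = totient , totient%8≡4 , atLeast⇒isTotient preimages , preimages
  where
  K = k + suc k
  primes = dickson⇒candidates-prime dickson K
  seed = proj₁ primes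
  t = suc (2 * seed)
  totient = 4 * (3 ^ K * (t * t))
  preimages : AtLeast (suc k) totient
  preimages = candidate-pairs⇒AtLeast t k (proj₂ primes)
  totient%8≡4 : totient % 8 ≡ 4
  totient%8≡4 = [4*odd]%8≡4 (3 ^ K * (t * t))
    (odd-* {3 ^ K} (odd-^ refl K) (odd-* {t} {t} ([1+2n]%2≡1 seed) ([1+2n]%2≡1 seed)))
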